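{- Let $\mathsf{D}$ be an optiongraph and let $\theta$ be a congruence relation on $\mathsf{D}$. Then the minimum quotient $\mathsf{D}/{\bowtie_{\mathsf{D}}}$ of $\mathsf{D}$ is isomorphic to the minimum quotient $(\mathsf{D}/\theta)/{\bowtie_{\mathsf{D}/\theta}}$ of $\mathsf{D}/\theta$.
   Context: An optiongraph is a nonempty set $\mathsf{D}$ (of positions, possibly infinite) together with an option function $\mathrm{Opt}_{\mathsf{D}}:\mathsf{D}\to 2^{\mathsf{D}}$. A function $f:\mathsf{C}\to\mathsf{D}$ is option preserving if $\mathrm{Opt}_{\mathsf{D}}(f(p))=f(\mathrm{Opt}_{\mathsf{C}}(p))$ for all $p$; an isomorphism is a bijective option-preserving map. For an equivalence relation $\theta$, write $[p]$ for the class of $p$ and $[S]:=\{[s]\mid s\in S\}$. An equivalence relation on an optiongraph is a congruence relation if $p\mathrel{\theta}q$ implies $[\mathrm{Opt}(p)]=[\mathrm{Opt}(q)]$. For an optiongraph $\mathsf{E}$, the union $\bowtie_{\mathsf{E}}$ of all congruence relations on $\mathsf{E}$ is itself a congruence relation (the maximum one). For a congruence relation $\theta$, the quotient optiongraph $\mathsf{D}/\theta$ is the set of classes with option function $\mathrm{Opt}_{\mathsf{D}/\theta}([p]):=[\mathrm{Opt}_{\mathsf{D}}(p)]$; $\mathsf{E}/{\bowtie_{\mathsf{E}}}$ is the minimum quotient of $\mathsf{E}$. -}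

module Defs where

open import Level using (Level; _⊔_; suc; Lift; lift)
open import Data.Product using (Σ; _×_; _,_; ∃; ∃-syntax)
open import Relation.Binary.Core using (Rel; _⇒_)
open import Relation.Binary.Structures using (IsEquivalence)
open import Relation.Unary using (Pred)

-- Sets are represented as setoids (Carrier, _≈_), since Agda has no
-- quotient types.  A subset of a setoid is a predicate; the class-image
-- of a subset is represented by the predicate itself.

_≐[_]_ : ∀ {c ℓ p q} {A : Set c} → Pred A p → Rel A ℓ → Pred A q → Set (c ⊔ ℓ ⊔ p ⊔ q)
S ≐[ _∼_ ] T = (∀ x → S x → ∃[ y ] (T y × (x ∼ y)))
             × (∀ y → T y → ∃[ x ] (S x × (x ∼ y)))

record Optiongraph (c ℓ o : Level) : Set (suc (c ⊔ ℓ ⊔ o)) where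
  field
    Carrier  : Set c
    _≈_      : Rel Carrier ℓ
    isEquiv  : IsEquivalence _≈_
    point    : Carrier                       -- nonemptiness
    Opt      : Carrier → Pred Carrier o
    Opt-resp : ∀ {p q} → p ≈ q → Opt p ≐[ _≈_ ] Opt q   -- Opt is a function on the set

open Optiongraph public

-- Congruence relation θ on D: an equivalence relation on the set of positions
-- (hence compatible with the underlying equality) such that
-- p θ q implies [Opt p] = [Opt q] (as sets of θ-classes).
record IsCongruence {c ℓ o r} (D : Optiongraph c ℓ o) (θ : Rel (Carrier D) r) : Set (c ⊔ ℓ ⊔ o ⊔ r) where
  field
    isEquiv : IsEquivalence θ
    ≈⊆θ     : _≈_ D ⇒ θ
    cong    : ∀ {p q} → θ p q → Opt D p ≐[ θ ] Opt D q

-- The union of all congruence relations (ranging over relations of level c ⊔ ℓ ⊔ o).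
⋈ : ∀ {c ℓ o} (D : Optiongraph c ℓ o) → Rel (Carrier D) (suc (c ⊔ ℓ ⊔ o))
⋈ {c} {ℓ} {o} D p q = Σ (Rel (Carrier D) (c ⊔ ℓ ⊔ o)) λ θ → IsCongruence D θ × θ p q

-- Quotient optiongraph D/θ: positions are θ-classes (carrier with equality θ),
-- Opt([p]) := [Opt(p)] = { [s] | s ∈ Opt p }.
quotient : ∀ {c ℓ o r} (D : Optiongraph c ℓ o) (θ : Rel (Carrier D) r) →
           IsCongruence D θ → Optiongraph c r (c ⊔ o ⊔ r)
quotient D θ cg = record
  { Carrier  = Carrier D
  ; _≈_      = θ
  ; isEquiv  = IsCongruence.isEquiv cg
  ; point    = point D
  ; Opt      = λ p x → ∃[ s ] (Opt D p s × θ s x)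
  ; Opt-resp = resp
  }
  where
  open IsEquivalence (IsCongruence.isEquiv cg)
  resp : ∀ {p q} → θ p q →
         (λ x → ∃[ s ] (Opt D p s × θ s x)) ≐[ θ ] (λ x → ∃[ s ] (Opt D q s × θ s x))
  resp pq with IsCongruence.cong cg pq
  ... | (f , g) =
    (λ x (s , os , sx) → let (t , ot , st) = f s os in t , (t , ot , refl) , trans (sym sx) st)
    , (λ y (t , ot , ty) → let (s , os , st) = g t ot in s , (s , os , refl) , trans st ty)

≐-mono : ∀ {c ℓ ℓ' p q} {A : Set c} {R : Rel A ℓ} {R' : Rel A ℓ'} {S : Pred A p} {T : Pred A q} →
         R ⇒ R' → S ≐[ R ] T → S ≐[ R' ] T
≐-mono h (f , g) = (λ x sx → let (y , ty , xy) = f x sx in y , ty , h xy)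
                 , (λ y ty → let (x , sx , xy) = g y ty in x , sx , h xy)

≐-trans : ∀ {c ℓ p q o} {A : Set c} {R : Rel A ℓ} {S : Pred A p} {T : Pred A q} {U : Pred A o} →
          (∀ {x y z} → R x y → R y z → R x z) → S ≐[ R ] T → T ≐[ R ] U → S ≐[ R ] U
≐-trans tr (f , g) (f' , g') =
    (λ x sx → let (y , ty , xy) = f x sx ; (z , uz , yz) = f' y ty in z , uz , tr xy yz)
  , (λ z uz → let (y , ty , yz) = g' z uz ; (x , sx , xy) = g y ty in x , sx , tr xy yz)

data TC {a r} {A : Set a} (R S : Rel A r) : Rel A (a ⊔ r) where
  inl : ∀ {x y} → R x y → TC R S x y
  inr : ∀ {x y} → S x y → TC R S x y
  _▸_ : ∀ {x y z} → TC R S x y → TC R S y z → TC R S x z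

private
  tc-sym : ∀ {a r} {A : Set a} {R S : Rel A r} →
           (∀ {x y} → R x y → R y x) → (∀ {x y} → S x y → S y x) →
           ∀ {x y} → TC R S x y → TC R S y x
  tc-sym sR sS (inl h) = inl (sR h)
  tc-sym sR sS (inr h) = inr (sS h)
  tc-sym sR sS (h ▸ k) = tc-sym sR sS k ▸ tc-sym sR sS h

  tc-cong : ∀ {c ℓ o r} (D : Optiongraph c ℓ o) {R S : Rel (Carrier D) r} →
            IsCongruence D R → IsCongruence D S →
            ∀ {x y} → TC R S x y → Opt D x ≐[ TC R S ] Opt D y
  tc-cong D cR cS (inl h) = ≐-mono inl (IsCongruence.cong cR h)
  tc-cong D cR cS (inr h) = ≐-mono inr (IsCongruence.cong cS h)
  tc-cong D cR cS (h ▸ k) = ≐-trans _▸_ (tc-cong D cR cS h) (tc-cong D cR cS k)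

  tc-isCong : ∀ {c ℓ o r} (D : Optiongraph c ℓ o) {R S : Rel (Carrier D) r} →
              IsCongruence D R → IsCongruence D S → IsCongruence D (TC R S)
  tc-isCong D cR cS = record
    { isEquiv = record
        { refl  = inl (IsEquivalence.refl (IsCongruence.isEquiv cR))
        ; sym   = tc-sym (IsEquivalence.sym (IsCongruence.isEquiv cR))
                         (IsEquivalence.sym (IsCongruence.isEquiv cS))
        ; trans = _▸_
        }
    ; ≈⊆θ  = λ h → inl (IsCongruence.≈⊆θ cR h)
    ; cong = tc-cong D cR cS
    }

  idCong : ∀ {c ℓ o} (D : Optiongraph c ℓ o) → IsCongruence D (λ x y → Lift (c ⊔ ℓ ⊔ o) (_≈_ D x y))
  idCong {c} {ℓ} {o} D = record
    { isEquiv = record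
        { refl  = lift (IsEquivalence.refl (isEquiv D))
        ; sym   = λ (lift h) → lift (IsEquivalence.sym (isEquiv D) h)
        ; trans = λ (lift h) (lift k) → lift (IsEquivalence.trans (isEquiv D) h k)
        }
    ; ≈⊆θ  = lift
    ; cong = λ (lift h) → ≐-mono lift (Opt-resp D h)
    }

-- The union of all congruences is a congruence (asserted in the paper's
-- context); proved here, since it is needed to form the minimum quotient.
⋈-isCongruence : ∀ {c ℓ o} (D : Optiongraph c ℓ o) → IsCongruence D (⋈ D)
⋈-isCongruence D = record
  { isEquiv = record
      { refl  = _ , idCong D , lift (IsEquivalence.refl (isEquiv D))
      ; sym   = λ (θ , cg , pq) → θ , cg , IsEquivalence.sym (IsCongruence.isEquiv cg) pq
      ; trans = λ (θ₁ , c₁ , pq) (θ₂ , c₂ , qr) →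
                  TC θ₁ θ₂ , tc-isCong D c₁ c₂ , (inl pq ▸ inr qr)
      }
  ; ≈⊆θ  = λ pq → _ , idCong D , lift pq
  ; cong = λ (θ , cg , pq) → ≐-mono (λ h → θ , cg , h) (IsCongruence.cong cg pq)
  }

minQuotient : ∀ {c ℓ o} (E : Optiongraph c ℓ o) → Optiongraph c (suc (c ⊔ ℓ ⊔ o)) (suc (c ⊔ ℓ ⊔ o))
minQuotient E = quotient E (⋈ E) (⋈-isCongruence E)

-- Option-preserving maps and isomorphisms (setoid version: maps respect
-- equality; bijective = injective and surjective w.r.t. the equalities).
record IsIsomorphism {c₁ ℓ₁ o₁ c₂ ℓ₂ o₂} (C : Optiongraph c₁ ℓ₁ o₁) (D : Optiongraph c₂ ℓ₂ o₂)
                     (f : Carrier C → Carrier D) : Set (c₁ ⊔ ℓ₁ ⊔ o₁ ⊔ c₂ ⊔ ℓ₂ ⊔ o₂) where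
  field
    well-defined : ∀ {p q} → _≈_ C p q → _≈_ D (f p) (f q)
    injective    : ∀ {p q} → _≈_ D (f p) (f q) → _≈_ C p q
    surjective   : ∀ y → ∃[ x ] (_≈_ D (f x) y)
    opt-preserving : ∀ p → Opt D (f p) ≐[ _≈_ D ] (λ y → ∃[ s ] (Opt C p s × _≈_ D (f s) y))

_≅_ : ∀ {c₁ ℓ₁ o₁ c₂ ℓ₂ o₂} → Optiongraph c₁ ℓ₁ o₁ → Optiongraph c₂ ℓ₂ o₂ → Set (c₁ ⊔ ℓ₁ ⊔ o₁ ⊔ c₂ ⊔ ℓ₂ ⊔ o₂)
C ≅ D = Σ (Carrier C → Carrier D) (IsIsomorphism C D)

{-# OPTIONS --safe #-}
-- The congruences of D/θ are exactly the congruences of D that contain θ.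
-- Every congruence R of D lies inside the congruence generated by R and θ,
-- which contains θ, so ⋈_D and ⋈_{D/θ} are the same relation on positions;
-- hence the identity on positions is an isomorphism between the two minimum
-- quotients.
module Submission where

open import Level using (Level; _⊔_)
open import Function using (id)
open import Data.Product using (_×_; _,_; ∃-syntax)
open import Relation.Binary.Core using (Rel; _⇒_)
open import Relation.Binary.Definitions using (Reflexive; Symmetric)
open import Relation.Binary.Structures using (IsEquivalence)
open import Relation.Unary using (Pred)
open import Defs

private
  variable
    a c ℓ o p q r φ : Level

saturate : {A : Set a} → Rel A r → Pred A p → Pred A (a ⊔ r ⊔ p)
saturate θ P x = ∃[ s ] (P s × θ s x)

≐-sym : {A : Set a} {R : Rel A r} {S : Pred A p} {T : Pred A q} →
        Symmetric R → S ≐[ R ] T → T ≐[ R ] S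
≐-sym sym (f , g) =
    (λ y ty → let (x , sx , xy) = g y ty in x , sx , sym xy)
  , (λ x sx → let (y , ty , xy) = f x sx in y , ty , sym xy)

saturate-≐ : {A : Set a} {θ : Rel A r} {Φ : Rel A φ} {P : Pred A p} →
             Reflexive θ → Symmetric Φ → θ ⇒ Φ → saturate θ P ≐[ Φ ] P
saturate-≐ θ-refl Φ-sym θ⇒Φ =
    (λ x (s , Ps , sx) → s , Ps , Φ-sym (θ⇒Φ sx))
  , (λ s Ps → s , (s , Ps , θ-refl) , θ⇒Φ θ-refl)

module _ (D : Optiongraph c ℓ o) {R S : Rel (Carrier D) r}
         (cR : IsCongruence D R) (cS : IsCongruence D S) where

  private
    module R = IsEquivalence (IsCongruence.isEquiv cR)
    module S = IsEquivalence (IsCongruence.isEquiv cS)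

  TC-sym : ∀ {x y} → TC R S x y → TC R S y x
  TC-sym (inl h) = inl (R.sym h)
  TC-sym (inr h) = inr (S.sym h)
  TC-sym (h ▸ k) = TC-sym k ▸ TC-sym h

  TC-Opt-≐ : ∀ {x y} → TC R S x y → Opt D x ≐[ TC R S ] Opt D y
  TC-Opt-≐ (inl h) = ≐-mono inl (IsCongruence.cong cR h)
  TC-Opt-≐ (inr h) = ≐-mono inr (IsCongruence.cong cS h)
  TC-Opt-≐ (h ▸ k) = ≐-trans _▸_ (TC-Opt-≐ h) (TC-Opt-≐ k)

  TC-isCongruence : IsCongruence D (TC R S)
  TC-isCongruence = record
    { isEquiv = record { refl = inl R.refl ; sym = TC-sym ; trans = _▸_ }
    ; ≈⊆θ     = λ h → inl (IsCongruence.≈⊆θ cR h)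
    ; cong    = TC-Opt-≐
    }

module _ (D : Optiongraph c ℓ o) {θ : Rel (Carrier D) r} (cg : IsCongruence D θ) where

  private
    Q = quotient D θ cg
    module θ = IsEquivalence (IsCongruence.isEquiv cg)

  Opt-quotient-≐ : {Φ : Rel (Carrier D) φ} → IsEquivalence Φ → θ ⇒ Φ →
                   ∀ x → Opt Q x ≐[ Φ ] Opt D x
  Opt-quotient-≐ eqΦ θ⇒Φ _ = saturate-≐ θ.refl (IsEquivalence.sym eqΦ) θ⇒Φ

  quotient-isCongruence : {Φ : Rel (Carrier D) φ} →
                          IsCongruence D Φ → θ ⇒ Φ → IsCongruence Q Φ
  quotient-isCongruence {Φ = Φ} cΦ θ⇒Φ = record
    { isEquiv = eqΦ
    ; ≈⊆θ     = θ⇒Φ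
    ; cong    = λ {x} {y} xy →
        ≐-trans Φ.trans (Opt-quotient-≐ eqΦ θ⇒Φ x)
          (≐-trans Φ.trans (IsCongruence.cong cΦ xy)
            (≐-sym Φ.sym (Opt-quotient-≐ eqΦ θ⇒Φ y)))
    }
    where
    eqΦ = IsCongruence.isEquiv cΦ
    module Φ = IsEquivalence eqΦ

  isCongruence-from-quotient : {Φ : Rel (Carrier D) φ} →
                               IsCongruence Q Φ → IsCongruence D Φ
  isCongruence-from-quotient {Φ = Φ} cΦ = record
    { isEquiv = eqΦ
    ; ≈⊆θ     = λ h → θ⇒Φ (IsCongruence.≈⊆θ cg h)
    ; cong    = λ {x} {y} xy →
        ≐-trans Φ.trans (≐-sym Φ.sym (Opt-quotient-≐ eqΦ θ⇒Φ x))
          (≐-trans Φ.trans (IsCongruence.cong cΦ xy) (Opt-quotient-≐ eqΦ θ⇒Φ y))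
    }
    where
    eqΦ = IsCongruence.isEquiv cΦ
    θ⇒Φ = IsCongruence.≈⊆θ cΦ
    module Φ = IsEquivalence eqΦ

  id-quotient≅quotient-of-quotient :
    {R : Rel (Carrier D) p} {S : Rel (Carrier D) q}
    (cR : IsCongruence D R) (cS : IsCongruence Q S) → R ⇒ S → S ⇒ R →
    IsIsomorphism (quotient D R cR) (quotient Q S cS) id
  id-quotient≅quotient-of-quotient {R = R} {S} cR cS R⇒S S⇒R = record
    { well-defined   = R⇒S
    ; injective      = S⇒R
    ; surjective     = λ y → y , S.refl
    ; opt-preserving = λ x →
        -- both sides are saturations of Opt D x: under θ then S, and under R then S
        ≐-trans S.trans (saturate-≐ S.refl S.sym id)
          (≐-trans S.trans (Opt-quotient-≐ eqS θ⇒S x)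
            (≐-trans S.trans (≐-sym S.sym (saturate-≐ R.refl S.sym R⇒S))
              (≐-sym S.sym (saturate-≐ S.refl S.sym id))))
    }
    where
    eqS = IsCongruence.isEquiv cS
    θ⇒S = IsCongruence.≈⊆θ cS
    module S = IsEquivalence eqS
    module R = IsEquivalence (IsCongruence.isEquiv cR)

module _ (D : Optiongraph c ℓ o) {θ : Rel (Carrier D) (c ⊔ ℓ ⊔ o)}
         (cg : IsCongruence D θ) where

  ⋈-quotient⇒⋈ : ⋈ (quotient D θ cg) ⇒ ⋈ D
  ⋈-quotient⇒⋈ (Φ , cΦ , xy) = Φ , isCongruence-from-quotient D cg cΦ , xy

  ⋈⇒⋈-quotient : ⋈ D ⇒ ⋈ (quotient D θ cg)
  ⋈⇒⋈-quotient (R , cR , xy) =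
    TC R θ , quotient-isCongruence D cg (TC-isCongruence D cR cg) inr , inl xy

mainTheorem12 : ∀ {c ℓ o} (D : Optiongraph c ℓ o) (θ : Rel (Carrier D) (c ⊔ ℓ ⊔ o))
                (cg : IsCongruence D θ) →
                minQuotient D ≅ minQuotient (quotient D θ cg)
mainTheorem12 D θ cg =
  id , id-quotient≅quotient-of-quotient D cg
         (⋈-isCongruence D) (⋈-isCongruence (quotient D θ cg))
         (⋈⇒⋈-quotient D cg) (⋈-quotient⇒⋈ D cg)
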